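{- Let $G$ be a connected block graph on at least two vertices, let $S$ be the set of its simplicial vertices, and let $W$ be a maximal clique of minimum cardinality in $G$. Then (i) $\mu^{ - }_t(G)=|S|$, and (ii) $\mu^{ - }(G)=|V(W)|$.
   Context: A block of $G$ is a maximal subgraph without a cut-vertex; $G$ is a block graph if every block is a complete graph. A vertex is simplicial if its neighborhood induces a complete graph. A maximal clique is a complete subgraph not contained in a larger one. For $X\subseteq V(G)$, two vertices $a,b$ are $X$-visible if there is a shortest $a,b$-path $P$ with $V(P)\cap X\subseteq\{a,b\}$. $X$ is a mutual-visibility set if every two vertices of $X$ are $X$-visible, and a total mutual-visibility set if every two vertices of $G$ are $X$-visible; such a set is maximal if no proper superset has the same property. $\mu^{ - }(G)$ (resp. $\mu^{ - }_t(G)$) is the minimum cardinality of a maximal mutual-visibility (resp. maximal total mutual-visibility) set. -}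

module Defs where

open import Data.Nat using (ℕ; zero; suc; _≤_)
open import Data.Bool using (Bool; T)
open import Data.Fin using (Fin)
open import Data.Fin.Subset using (Subset; _∈_; _∉_; _⊆_; ∣_∣; _-_)
open import Data.List using (List; []; _∷_)
open import Data.List.Relation.Unary.All using (All)
open import Data.Product using (Σ; ∃; _×_; _,_)
open import Data.Sum using (_⊎_)
open import Relation.Binary.PropositionalEquality using (_≡_; _≢_)
open import Relation.Nullary using (¬_)

record Graph (n : ℕ) : Set where
  field
    adj    : Fin n → Fin n → Bool
    sym    : ∀ u v → T (adj u v) → T (adj v u)
    irrefl : ∀ v → ¬ T (adj v v)

module _ {n : ℕ} (G : Graph n) where
  open Graph G

  E : Fin n → Fin n → Set
  E u v = T (adj u v)

  data Walk : Fin n → Fin n → Set where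
    [] : ∀ {a} → Walk a a
    _∷_ : ∀ {a b c} → E a b → Walk b c → Walk a c

  len : ∀ {a b} → Walk a b → ℕ
  len [] = zero
  len (_ ∷ p) = suc (len p)

  verts : ∀ {a b} → Walk a b → List (Fin n)
  verts {a} [] = a ∷ []
  verts {a} (_ ∷ p) = a ∷ verts p

  -- a shortest a,b-path (a shortest walk is automatically a path)
  Shortest : ∀ {a b} → Walk a b → Set
  Shortest {a} {b} p = ∀ (q : Walk a b) → len p ≤ len q

  Connected : Set
  Connected = ∀ (a b : Fin n) → Walk a b

  Visible : Subset n → Fin n → Fin n → Set
  Visible X a b = Σ (Walk a b) λ p →
    Shortest p × All (λ v → v ∈ X → (v ≡ a) ⊎ (v ≡ b)) (verts p)

  IsMutualVisibility : Subset n → Set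
  IsMutualVisibility X = ∀ a b → a ∈ X → b ∈ X → Visible X a b

  IsTotalMutualVisibility : Subset n → Set
  IsTotalMutualVisibility X = ∀ a b → Visible X a b

  Maximal : (Subset n → Set) → Subset n → Set
  Maximal P X = P X × (∀ Y → X ⊆ Y → P Y → Y ≡ X)

  IsMinCard : (Subset n → Set) → ℕ → Set
  IsMinCard P k = (Σ (Subset n) λ X → P X × ∣ X ∣ ≡ k) × (∀ X → P X → k ≤ ∣ X ∣)

  InsideWalk : Subset n → Fin n → Fin n → Set
  InsideWalk B a b = Σ (Walk a b) λ p → All (λ v → v ∈ B) (verts p)

  InducedConnected : Subset n → Set
  InducedConnected B = ∀ a b → a ∈ B → b ∈ B → InsideWalk B a b

  NoCutVertex : Subset n → Set
  NoCutVertex B = (∃ λ v → v ∈ B) × InducedConnected B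
                × (∀ x → x ∈ B → InducedConnected (B - x))

  -- a block: a maximal (connected) subgraph without a cut-vertex
  -- (maximal such subgraphs are induced, so vertex subsets suffice)
  IsBlock : Subset n → Set
  IsBlock = Maximal NoCutVertex

  Complete : Subset n → Set
  Complete B = ∀ u v → u ∈ B → v ∈ B → u ≢ v → E u v

  IsBlockGraph : Set
  IsBlockGraph = ∀ B → IsBlock B → Complete B

  Simplicial : Fin n → Set
  Simplicial v = ∀ u w → E v u → E v w → u ≢ w → E u w

  IsMaximalClique : Subset n → Set
  IsMaximalClique = Maximal Complete

  μ⁻≡ : ℕ → Set
  μ⁻≡ = IsMinCard (Maximal IsMutualVisibility)

  μ⁻t≡ : ℕ → Set
  μ⁻t≡ = IsMinCard (Maximal IsTotalMutualVisibility)

-- In a block graph a common neighbour a of two non-adjacent vertices lies on every walk between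
-- them: a path avoiding a would close a cycle, which has no cut-vertex and so lies in a block,
-- and blocks are complete.
--
-- (i) A simplicial vertex is never an inner vertex of a shortest path, so the simplicial vertices
-- form a total mutual-visibility set; conversely a non-simplicial vertex of such a set would be a
-- common neighbour of two non-adjacent vertices and block every shortest path between them.
-- Hence S contains every total mutual-visibility set and is the only maximal one.
--
-- (ii) A maximal clique is a maximal mutual-visibility set. Conversely, a maximal clique B is
-- gated: every vertex x has a gate in B lying on all walks from x into B. For a maximal
-- mutual-visibility set X, take B through the first edge of a shortest path between two vertices
-- of X, whose gates then differ; a vertex of B that is the gate of no vertex of X could be added
-- to X. So the gates of X cover B, and ∣ X ∣ ≥ ∣ B ∣ ≥ ∣ W ∣.

module Submission where

open import Defs
open import Data.Nat using (ℕ; zero; suc; _+_; _≤_; _<_; z≤n; s≤s)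
open import Data.Nat.Properties
  using (≤-refl; ≤-trans; ≤-reflexive; n≤1+n; ≤-pred; ≰⇒>; ≤⇒≯; m≤n+m; +-comm; +-cancelˡ-≤; +-cancelʳ-≤; +-mono-≤; module ≤-Reasoning)
  renaming (_≤?_ to _≤ℕ?_)
open import Data.Bool.Properties using (T?)
open import Data.Fin.Properties using (any?)
open import Data.Fin using (Fin; zero; suc; _≟_)
open import Data.Fin.Subset using (Subset; _∈_; _∉_; _⊆_; _⊂_; _⊃_; _⊄_; ∣_∣; _-_; _∪_; ⁅_⁆; inside; outside) renaming (⊥ to ∅)
open import Data.Fin.Subset.Properties
  using (_∈?_; _⊂?_; nonempty?; Empty-unique; ∣⊥∣≡0; p─⊥≡p; p─q⊆p; x∈p∧x≢y⇒x∈p-y; x∈p⇒p-x⊂p; ∉⊥; x∈p∪q⁻; x∈⁅y⁆⇒x≡y;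
         x∈p⇒∣p-x∣<∣p∣; ⊆-refl; ⊆-trans; ⊆-antisym; p⊆p∪q; x∈p∪q⁺; x∈⁅x⁆)
open import Data.Fin.Subset.Induction using (⊂-wellFounded; ⊃-wellFounded)
open import Data.Vec using (_∷_; here; there)
open import Data.List using (List; []; _∷_)
open import Data.List.Membership.Propositional using () renaming (_∈_ to _∈ₗ_)
open import Data.List.Relation.Unary.Any using (here; there)
import Data.List.Relation.Unary.All as All
open import Data.Product using (Σ; ∃-syntax; _×_; _,_; proj₁; proj₂)
open import Data.Sum using (_⊎_; inj₁; inj₂)
import Data.Sum as Sum
open import Data.Unit using (⊤; tt)
open import Data.Empty using (⊥; ⊥-elim)
open import Function using (_∘_; case_of_)
open import Induction.WellFounded using (Acc; acc)
open import Relation.Binary.PropositionalEquality using (_≡_; _≢_; refl; sym; trans; cong; subst; subst₂)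
open import Relation.Nullary using (¬_; Dec; yes; no; contradiction)
open import Function.Bundles using (_⇔_; Equivalence)
open import Relation.Nullary.Decidable using (decidable-stable; _×-dec_; ¬?)

private variable
  n : ℕ
  p q : Subset n

x∉p-x : ∀ (p : Subset n) x → x ∉ p - x
x∉p-x (s ∷ p) zero    ()
x∉p-x (s ∷ p) (suc x) (there x∈p-x) = x∉p-x p x x∈p-x

x∈p-y⇒x≢y : ∀ {x y : Fin n} → x ∈ p - y → x ≢ y
x∈p-y⇒x≢y {p = p} {x} x∈p-x refl = x∉p-x p x x∈p-x

∣p∣≤1+∣p-x∣ : ∀ (p : Subset n) x → ∣ p ∣ ≤ suc ∣ p - x ∣
∣p∣≤1+∣p-x∣ (inside  ∷ p) zero    = s≤s (≤-reflexive (cong ∣_∣ (sym (p─⊥≡p p))))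
∣p∣≤1+∣p-x∣ (outside ∷ p) zero    = ≤-trans (≤-reflexive (cong ∣_∣ (sym (p─⊥≡p p)))) (n≤1+n _)
∣p∣≤1+∣p-x∣ (inside  ∷ p) (suc x) = s≤s (∣p∣≤1+∣p-x∣ p x)
∣p∣≤1+∣p-x∣ (outside ∷ p) (suc x) = ∣p∣≤1+∣p-x∣ p x

p⊆f[q]⇒∣p∣≤∣q∣ : (f : Fin n → Fin n) → (∀ {b} → b ∈ p → ∃[ x ] x ∈ q × f x ≡ b) → ∣ p ∣ ≤ ∣ q ∣
p⊆f[q]⇒∣p∣≤∣q∣ {n = n} {p = p} {q} f = go p q (⊂-wellFounded p)
  where
  go : ∀ p q → Acc _⊂_ p → (∀ {b} → b ∈ p → ∃[ x ] x ∈ q × f x ≡ b) → ∣ p ∣ ≤ ∣ q ∣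
  go p q (acc rec) cover with nonempty? p
  ... | no p-empty = ≤-trans (≤-reflexive (trans (cong ∣_∣ (Empty-unique p-empty)) (∣⊥∣≡0 n))) z≤n
  ... | yes (_ , b∈p) with cover b∈p
  ...   | x , x∈q , refl = begin
    ∣ p ∣                ≤⟨ ∣p∣≤1+∣p-x∣ p (f x) ⟩
    suc ∣ p - f x ∣      ≤⟨ s≤s (go (p - f x) (q - x) (rec (x∈p⇒p-x⊂p b∈p)) cover-x) ⟩
    suc ∣ q - x ∣        ≤⟨ x∈p⇒∣p-x∣<∣p∣ x∈q ⟩
    ∣ q ∣                ∎
    where
    open ≤-Reasoning
    cover-x : ∀ {b} → b ∈ p - f x → ∃[ x′ ] x′ ∈ q - x × f x′ ≡ b
    cover-x b∈p-fx with cover (p─q⊆p p _ b∈p-fx)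
    ... | x′ , x′∈q , refl = x′ , x∈p∧x≢y⇒x∈p-y x′∈q (λ { refl → x∈p-y⇒x≢y b∈p-fx refl }) , refl

two-distinct : 2 ≤ n → Σ (Fin n) λ i → Σ (Fin n) λ j → i ≢ j
two-distinct (s≤s (s≤s _)) = zero , suc zero , λ ()

⊆∧⊄⇒≡ : p ⊆ q → p ⊄ q → q ≡ p
⊆∧⊄⇒≡ {p = p} p⊆q p⊄q = ⊆-antisym
  (λ {x} x∈q → decidable-stable (x ∈? p) (λ x∉p → p⊄q (p⊆q , x , x∈q , x∉p))) p⊆q

module _ {n : ℕ} (G : Graph n) where
  open Graph G using (adj; irrefl)
  open import Data.List.Membership.DecPropositional (_≟_ {n}) using () renaming (_∈?_ to _∈ₗ?_)

  private variable
    a b c g h u v w x : Fin n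
    P : Subset n → Set
    B X Y : Subset n

  ¬¬-maximal-extension : P X → ¬ ¬ (∃[ Z ] X ⊆ Z × Maximal G P Z)
  ¬¬-maximal-extension {P = P} {X = X} PX = go X (⊃-wellFounded X) PX ⊆-refl
    where
    go : ∀ Z → Acc _⊃_ Z → P Z → X ⊆ Z → ¬ ¬ (∃[ Z′ ] X ⊆ Z′ × Maximal G P Z′)
    go Z (acc rec) PZ X⊆Z no-maximal = no-maximal (Z , X⊆Z , PZ , maximal)
      where
      maximal : ∀ Z′ → Z ⊆ Z′ → P Z′ → Z′ ≡ Z
      maximal Z′ Z⊆Z′ PZ′ with Z ⊂? Z′
      ... | yes Z⊂Z′ = ⊥-elim (go Z′ (rec Z⊂Z′) PZ′ (⊆-trans X⊆Z Z⊆Z′) no-maximal)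
      ... | no  Z⊄Z′ = ⊆∧⊄⇒≡ Z⊆Z′ Z⊄Z′

  Maximal-∪⁅⁆⇒∈ : Maximal G P X → P (X ∪ ⁅ v ⁆) → v ∈ X
  Maximal-∪⁅⁆⇒∈ {X = X} {v = v} (_ , maximal) P[X∪v] =
    subst (v ∈_) (maximal (X ∪ ⁅ v ⁆) (p⊆p∪q ⁅ v ⁆) P[X∪v]) (x∈p∪q⁺ (inj₂ (x∈⁅x⁆ v)))

  maximal-if-no-strict-extension : P X → (∀ Y → X ⊂ Y → ¬ P Y) → Maximal G P X
  maximal-if-no-strict-extension {P = P} {X = X} PX no-extension = PX , maximal
    where
    maximal : ∀ Y → X ⊆ Y → P Y → Y ≡ X
    maximal Y X⊆Y PY with X ⊂? Y
    ... | yes X⊂Y = ⊥-elim (no-extension Y X⊂Y PY)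
    ... | no  X⊄Y = ⊆∧⊄⇒≡ X⊆Y X⊄Y

  greatest⇒IsMinCard-Maximal : P X → (∀ Y → P Y → Y ⊆ X) → IsMinCard G (Maximal G P) ∣ X ∣
  greatest⇒IsMinCard-Maximal {X = X} PX greatest =
      (X , (PX , λ Y X⊆Y PY → ⊆-antisym (greatest Y PY) X⊆Y) , refl)
    , λ Y (PY , maximal) → ≤-reflexive (cong ∣_∣ (maximal X (greatest Y PY) PX))

  -- Walks, paths and shortest walks

  infix  4 _~_ _∈ʷ_ _∉ʷ_
  infixr 5 _++ʷ_

  _~_ : Fin n → Fin n → Set
  _~_ = E G

  ~-sym : u ~ v → v ~ u
  ~-sym {u} {v} = Graph.sym G u v

  _∈ʷ_ : Fin n → Walk G a b → Set
  v ∈ʷ p = v ∈ₗ verts G p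

  _∉ʷ_ : Fin n → Walk G a b → Set
  v ∉ʷ p = ¬ v ∈ʷ p

  source∈ʷ : (p : Walk G a b) → a ∈ʷ p
  source∈ʷ []      = here refl
  source∈ʷ (_ ∷ p) = here refl

  target∈ʷ : (p : Walk G a b) → b ∈ʷ p
  target∈ʷ []      = here refl
  target∈ʷ (_ ∷ p) = there (target∈ʷ p)

  _++ʷ_ : Walk G a b → Walk G b c → Walk G a c
  []      ++ʷ q = q
  (e ∷ p) ++ʷ q = e ∷ (p ++ʷ q)

  len-++ʷ : (p : Walk G a b) (q : Walk G b c) → len G (p ++ʷ q) ≡ len G p + len G q
  len-++ʷ []      q = refl
  len-++ʷ (e ∷ p) q = cong suc (len-++ʷ p q)

  ∈ʷ-++⁻ : (p : Walk G a b) (q : Walk G b c) → v ∈ʷ p ++ʷ q → v ∈ʷ p ⊎ v ∈ʷ q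
  ∈ʷ-++⁻ []      q v∈q          = inj₂ v∈q
  ∈ʷ-++⁻ (e ∷ p) q (here refl)  = inj₁ (here refl)
  ∈ʷ-++⁻ (e ∷ p) q (there v∈pq) = Sum.map₁ there (∈ʷ-++⁻ p q v∈pq)

  ∈ʷ-++⁺ˡ : (p : Walk G a b) (q : Walk G b c) → v ∈ʷ p → v ∈ʷ p ++ʷ q
  ∈ʷ-++⁺ˡ []      q (here refl) = source∈ʷ q
  ∈ʷ-++⁺ˡ (e ∷ p) q (here refl) = here refl
  ∈ʷ-++⁺ˡ (e ∷ p) q (there v∈p) = there (∈ʷ-++⁺ˡ p q v∈p)

  ∈ʷ-++⁺ʳ : (p : Walk G a b) (q : Walk G b c) → v ∈ʷ q → v ∈ʷ p ++ʷ q
  ∈ʷ-++⁺ʳ []      q v∈q = v∈q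
  ∈ʷ-++⁺ʳ (e ∷ p) q v∈q = there (∈ʷ-++⁺ʳ p q v∈q)

  edge : a ~ b → Walk G a b
  edge e = e ∷ []

  reverse : Walk G a b → Walk G b a
  reverse []      = []
  reverse (e ∷ p) = reverse p ++ʷ edge (~-sym e)

  len-reverse : (p : Walk G a b) → len G (reverse p) ≡ len G p
  len-reverse []      = refl
  len-reverse (e ∷ p) = trans (len-++ʷ (reverse p) _) (trans (+-comm _ 1) (cong suc (len-reverse p)))

  ∈ʷ-reverse⁻ : (p : Walk G a b) → v ∈ʷ reverse p → v ∈ʷ p
  ∈ʷ-reverse⁻ []      v∈p = v∈p
  ∈ʷ-reverse⁻ (e ∷ p) v∈rp with ∈ʷ-++⁻ (reverse p) (edge (~-sym e)) v∈rp
  ... | inj₁ v∈rp′               = there (∈ʷ-reverse⁻ p v∈rp′)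
  ... | inj₂ (here refl)         = there (source∈ʷ p)
  ... | inj₂ (there (here refl)) = here refl

  split-at : (p : Walk G a b) → v ∈ʷ p → Σ (Walk G a v) λ p₁ → Σ (Walk G v b) λ p₂ → p₁ ++ʷ p₂ ≡ p
  split-at []      (here refl) = [] , [] , refl
  split-at (e ∷ p) (here refl) = [] , e ∷ p , refl
  split-at (e ∷ p) (there v∈p) with split-at p v∈p
  ... | p₁ , p₂ , refl = e ∷ p₁ , p₂ , refl

  len-pos : a ≢ b → (p : Walk G a b) → 1 ≤ len G p
  len-pos a≢a []      = contradiction refl a≢a
  len-pos _   (_ ∷ _) = s≤s z≤n

  ++ʷ-assoc : (p : Walk G a b) (q : Walk G b c) (r : Walk G c u) → (p ++ʷ q) ++ʷ r ≡ p ++ʷ (q ++ʷ r)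
  ++ʷ-assoc []      q r = refl
  ++ʷ-assoc (e ∷ p) q r = cong (e ∷_) (++ʷ-assoc p q r)

  ∈ʷ-++-edge⁻ : (p : Walk G a b) (e : b ~ c) → v ∈ʷ p ++ʷ edge e → v ∈ʷ p ⊎ v ≡ c
  ∈ʷ-++-edge⁻ p e v∈pe with ∈ʷ-++⁻ p (edge e) v∈pe
  ... | inj₁ v∈p               = inj₁ v∈p
  ... | inj₂ (here refl)       = inj₁ (target∈ʷ p)
  ... | inj₂ (there (here eq)) = inj₂ eq

  IsPath : Walk G a b → Set
  IsPath []          = ⊤
  IsPath {a} (_ ∷ p) = a ∉ʷ p × IsPath p

  IsPath-++ʳ : (p : Walk G a b) (q : Walk G b c) → IsPath (p ++ʷ q) → IsPath q
  IsPath-++ʳ []      q q-path        = q-path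
  IsPath-++ʳ (e ∷ p) q (_ , pq-path) = IsPath-++ʳ p q pq-path

  path-++-meet : (p : Walk G a b) (q : Walk G b c) → IsPath (p ++ʷ q) → v ∈ʷ p → v ∈ʷ q → v ≡ b
  path-++-meet []      q _             (here refl) _   = refl
  path-++-meet (e ∷ p) q (a∉pq , _)    (here refl) v∈q = contradiction (∈ʷ-++⁺ʳ p q v∈q) a∉pq
  path-++-meet (e ∷ p) q (_ , pq-path) (there v∈p) v∈q = path-++-meet p q pq-path v∈p v∈q

  walk⇒path : (p : Walk G a b) → Σ (Walk G a b) λ q → IsPath q × (∀ {v} → v ∈ʷ q → v ∈ʷ p)
  walk⇒path []          = [] , tt , λ v∈p → v∈p
  walk⇒path {a} (e ∷ p) with walk⇒path p
  ... | q , q-path , q⊆p with a ∈ₗ? verts G q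
  ...   | no a∉q = e ∷ q , (a∉q , q-path) , λ { (here refl) → here refl ; (there v∈q) → there (q⊆p v∈q) }
  ...   | yes a∈q with split-at q a∈q
  ...     | q₁ , q₂ , refl = q₂ , IsPath-++ʳ q₁ q₂ q-path , λ v∈q₂ → there (q⊆p (∈ʷ-++⁺ʳ q₁ q₂ v∈q₂))

  walk≤? : ∀ k a b → Dec (Σ (Walk G a b) λ p → len G p ≤ k)
  walk≤? k a b with a ≟ b
  ... | yes refl = yes ([] , z≤n)
  walk≤? zero    a b | no a≢b = no λ { ([] , _) → a≢b refl ; (_ ∷ _ , ()) }
  walk≤? (suc k) a b | no a≢b with any? (λ c → T? (adj a c) ×-dec walk≤? k c b)
  ... | yes (_ , a~c , p , len≤k) = yes (a~c ∷ p , s≤s len≤k)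
  ... | no  no-step = no λ { ([] , _) → a≢b refl ; (a~c ∷ p , s≤s len≤k) → no-step (_ , a~c , p , len≤k) }

  shortest-walk : Walk G a b → Σ (Walk G a b) (Shortest G)
  shortest-walk p = go (len G p) p ≤-refl
    where
    go : ∀ k (p : Walk G a b) → len G p ≤ k → Σ (Walk G a b) (Shortest G)
    go zero    p len≤0 = p , λ _ → ≤-trans len≤0 z≤n
    go (suc k) p len≤1+k with walk≤? k _ _
    ... | yes (q , len-q≤k) = go k q len-q≤k
    ... | no  no-shorter   = p , minimal
      where
      minimal : ∀ q → len G p ≤ len G q
      minimal q with len G p ≤ℕ? len G q
      ... | yes p≤q = p≤q
      ... | no  p≰q = contradiction (q , ≤-pred (≤-trans (≰⇒> p≰q) len≤1+k)) no-shorter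

  Shortest-reverse : (p : Walk G a b) → Shortest G p → Shortest G (reverse p)
  Shortest-reverse p p-short q =
    subst₂ _≤_ (sym (len-reverse p)) (len-reverse q) (p-short (reverse q))

  Shortest-++ʳ : (p : Walk G a b) (q : Walk G b c) → Shortest G (p ++ʷ q) → Shortest G q
  Shortest-++ʳ p q pq-short r =
    +-cancelˡ-≤ (len G p) _ _ (subst₂ _≤_ (len-++ʷ p q) (len-++ʷ p r) (pq-short (p ++ʷ r)))

  Shortest-edge : a ≢ b → (e : a ~ b) → Shortest G (edge e)
  Shortest-edge a≢b _ = len-pos a≢b

  Shortest⇒IsPath : (p : Walk G a b) → Shortest G p → IsPath p
  Shortest⇒IsPath []          _       = tt
  Shortest⇒IsPath {a} (e ∷ p) p-short = a∉p , Shortest⇒IsPath p (Shortest-++ʳ (edge e) p p-short)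
    where
    a∉p : a ∉ʷ p
    a∉p a∈p with split-at p a∈p
    ... | p₁ , p₂ , refl =
      ≤⇒≯ (subst (len G p₂ ≤_) (sym (len-++ʷ p₁ p₂)) (m≤n+m _ _)) (p-short p₂)

  Shortest-++ˡ : (p : Walk G a b) (q : Walk G b c) → Shortest G (p ++ʷ q) → Shortest G p
  Shortest-++ˡ p q pq-short r =
    +-cancelʳ-≤ (len G q) _ _ (subst₂ _≤_ (len-++ʷ p q) (len-++ʷ r q) (pq-short (r ++ʷ q)))

  Shortest-middle : (s₁ : Walk G a b) (s₂ : Walk G b c) (s₃ : Walk G c u) (s₄ : Walk G u v)
                  → Shortest G ((s₁ ++ʷ s₂) ++ʷ (s₃ ++ʷ s₄)) → Shortest G (s₂ ++ʷ s₃)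
  Shortest-middle s₁ s₂ s₃ s₄ R-short =
    Shortest-++ˡ (s₂ ++ʷ s₃) s₄ (subst (Shortest G) (sym (++ʷ-assoc s₂ s₃ s₄))
      (Shortest-++ʳ s₁ (s₂ ++ʷ s₃ ++ʷ s₄) (subst (Shortest G) (++ʷ-assoc s₁ s₂ (s₃ ++ʷ s₄)) R-short)))

  Visible-refl : Visible G X v v
  Visible-refl = [] , (λ _ → z≤n) , All.tabulate λ { (here refl) _ → inj₁ refl }

  Visible-reverse : Visible G X u v → Visible G X v u
  Visible-reverse (p , p-short , p-visible) = reverse p , Shortest-reverse p p-short ,
    All.tabulate λ z∈p⁻¹ z∈X → Sum.swap (All.lookup p-visible (∈ʷ-reverse⁻ p z∈p⁻¹) z∈X)

  first-step : x ≢ w → Walk G x w → ∃[ y ] x ~ y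
  first-step x≢x []      = contradiction refl x≢x
  first-step _   (e ∷ _) = _ , e

  has-neighbour : 2 ≤ n → Connected G → ∀ x → ∃[ y ] x ~ y
  has-neighbour 2≤n connected x with two-distinct 2≤n
  ... | i , j , i≢j with x ≟ i
  ...   | yes refl = first-step i≢j (connected x j)
  ...   | no  x≢i  = first-step x≢i (connected x i)

  Complete-⁅⁆ : Complete G ⁅ v ⁆
  Complete-⁅⁆ {v} u w u∈⁅v⁆ w∈⁅v⁆ u≢w = ⊥-elim (u≢w (trans (x∈⁅y⁆⇒x≡y v u∈⁅v⁆) (sym (x∈⁅y⁆⇒x≡y v w∈⁅v⁆))))

  Complete-∪⁅⁆ : Complete G X → (∀ {w} → w ∈ X → v ~ w) → Complete G (X ∪ ⁅ v ⁆)
  Complete-∪⁅⁆ {X} {v} X-complete v~X u w u∈ w∈ u≢w with x∈p∪q⁻ X ⁅ v ⁆ u∈ | x∈p∪q⁻ X ⁅ v ⁆ w∈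
  ... | inj₁ u∈X  | inj₁ w∈X  = X-complete u w u∈X w∈X u≢w
  ... | inj₁ u∈X  | inj₂ w∈⁅v⁆ rewrite x∈⁅y⁆⇒x≡y v w∈⁅v⁆ = ~-sym (v~X u∈X)
  ... | inj₂ u∈⁅v⁆ | inj₁ w∈X  rewrite x∈⁅y⁆⇒x≡y v u∈⁅v⁆ = v~X w∈X
  ... | inj₂ u∈⁅v⁆ | inj₂ w∈⁅v⁆ = Complete-⁅⁆ u w u∈⁅v⁆ w∈⁅v⁆ u≢w

  clique-geodesic : Complete G X → u ∈ X → v ∈ X
                  → Σ (Walk G u v) λ t → Shortest G t × len G t ≤ 1 × (∀ {z} → z ∈ʷ t → z ≡ u ⊎ z ≡ v)
  clique-geodesic {u = u} {v} X-complete u∈X v∈X with u ≟ v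
  ... | yes refl = [] , (λ _ → z≤n) , z≤n , λ { (here refl) → inj₁ refl }
  ... | no  u≢v  = let u~v = X-complete u v u∈X v∈X u≢v in
    edge u~v , Shortest-edge u≢v u~v , ≤-refl , λ { (here refl) → inj₁ refl ; (there (here refl)) → inj₂ refl }

  Complete⇒IsMutualVisibility : Complete G X → IsMutualVisibility G X
  Complete⇒IsMutualVisibility X-complete u v u∈X v∈X =
    let t , t-short , _ , t-ends = clique-geodesic X-complete u∈X v∈X in
    t , t-short , All.tabulate λ z∈t _ → t-ends z∈t

  maximal-clique-nonempty : IsMaximalClique G X → Fin n → ∃[ w ] w ∈ X
  maximal-clique-nonempty {X} X-max v with nonempty? X
  ... | yes X-nonempty = X-nonempty
  ... | no  X-empty    =
    v , Maximal-∪⁅⁆⇒∈ X-max (Complete-∪⁅⁆ (proj₁ X-max) λ w∈X → contradiction (_ , w∈X) X-empty)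

  maximal-clique-non-neighbour : IsMaximalClique G X → v ∉ X → ∃[ w ] w ∈ X × ¬ v ~ w
  maximal-clique-non-neighbour {X} {v} X-max v∉X with any? (λ w → w ∈? X ×-dec ¬? (T? (adj v w)))
  ... | yes non-neighbour = non-neighbour
  ... | no  none          = contradiction (Maximal-∪⁅⁆⇒∈ X-max (Complete-∪⁅⁆ (proj₁ X-max) v~X)) v∉X
    where
    v~X : w ∈ X → v ~ w
    v~X {w} w∈X = decidable-stable (T? (adj v w)) λ v≁w → none (w , w∈X , v≁w)

  Complete-subsingleton : (∀ {u w} → u ∈ X → w ∈ X → u ≡ w) → Complete G X
  Complete-subsingleton X-subsingleton u w u∈X w∈X u≢w = ⊥-elim (u≢w (X-subsingleton u∈X w∈X))

  -- Separation in block graphs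

  fromList : List (Fin n) → Subset n
  fromList []      = ∅
  fromList (v ∷ l) = ⁅ v ⁆ ∪ fromList l

  ∈-fromList⁺ : ∀ {l} → v ∈ₗ l → v ∈ fromList l
  ∈-fromList⁺ {l = v ∷ _} (here refl) = x∈p∪q⁺ (inj₁ (x∈⁅x⁆ v))
  ∈-fromList⁺ (there v∈l)             = x∈p∪q⁺ (inj₂ (∈-fromList⁺ v∈l))

  ∈-fromList⁻ : ∀ l → v ∈ fromList l → v ∈ₗ l
  ∈-fromList⁻ []      v∈⊥ = contradiction v∈⊥ ∉⊥
  ∈-fromList⁻ (u ∷ l) v∈l with x∈p∪q⁻ ⁅ u ⁆ (fromList l) v∈l
  ... | inj₁ v∈u  = here (x∈⁅y⁆⇒x≡y u v∈u)
  ... | inj₂ v∈l′ = there (∈-fromList⁻ l v∈l′)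

  walk-inside : (p : Walk G u v) → (∀ {z} → z ∈ʷ p → z ∈ X) → InsideWalk G X u v
  walk-inside p p⊆X = p , All.tabulate p⊆X

  InsideWalk-reverse : InsideWalk G X u v → InsideWalk G X v u
  InsideWalk-reverse (p , p⊆X) = walk-inside (reverse p) (All.lookup p⊆X ∘ ∈ʷ-reverse⁻ p)

  InsideWalk-++ : InsideWalk G X u v → InsideWalk G X v w → InsideWalk G X u w
  InsideWalk-++ (p , p⊆X) (q , q⊆X) =
    walk-inside (p ++ʷ q) (Sum.[ All.lookup p⊆X , All.lookup q⊆X ] ∘ ∈ʷ-++⁻ p q)

  InducedConnected-if-hub : (∀ {u} → u ∈ X → InsideWalk G X u w) → InducedConnected G X
  InducedConnected-if-hub to-hub u v u∈X v∈X = InsideWalk-++ (to-hub u∈X) (InsideWalk-reverse (to-hub v∈X))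

  -- Without a vertex x of P, every vertex of P still reaches a around the side of the cycle avoiding x.
  cycle-NoCutVertex : a ~ b → a ~ c → (P : Walk G b c) → IsPath P → a ∉ʷ P
                    → NoCutVertex G (fromList (a ∷ verts G P))
  cycle-NoCutVertex {a} {b} {c} a~b a~c P P-path a∉P =
    (a , a∈C) , InducedConnected-if-hub to-b , without
    where
    C : Subset n
    C = fromList (a ∷ verts G P)

    a∈C : a ∈ C
    a∈C = ∈-fromList⁺ {l = a ∷ verts G P} (here refl)

    P⊆C : v ∈ʷ P → v ∈ C
    P⊆C v∈P = ∈-fromList⁺ {l = a ∷ verts G P} (there v∈P)

    back-to-b : v ∈ʷ P → Σ (Walk G v b) λ q → ∀ {z} → z ∈ʷ q → z ∈ʷ P
    back-to-b v∈P with split-at P v∈P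
    ... | p₁ , p₂ , refl = reverse p₁ , ∈ʷ-++⁺ˡ p₁ p₂ ∘ ∈ʷ-reverse⁻ p₁

    to-b : v ∈ C → InsideWalk G C v b
    to-b v∈C with ∈-fromList⁻ (a ∷ verts G P) v∈C
    ... | here refl = walk-inside (edge a~b) λ { (here refl) → a∈C ; (there (here refl)) → P⊆C (source∈ʷ P) }
    ... | there v∈P = let q , q⊆P = back-to-b v∈P in walk-inside q (P⊆C ∘ q⊆P)

    detour : ∀ {x s t} → a ≢ x → (r : Walk G s t) → (∀ {z} → z ∈ʷ r → z ∈ʷ P) → x ∉ʷ r
           → (q : Walk G u a) → (∀ {z} → z ∈ʷ q → z ∈ʷ r ⊎ z ≡ a) → InsideWalk G (C - x) u a
    detour a≢x r r⊆P x∉r q q⊆r+a = walk-inside q λ z∈q → case q⊆r+a z∈q of λ where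
      (inj₁ z∈r) → x∈p∧x≢y⇒x∈p-y (P⊆C (r⊆P z∈r)) λ { refl → x∉r z∈r }
      (inj₂ refl) → x∈p∧x≢y⇒x∈p-y a∈C a≢x

    without : ∀ x → x ∈ C → InducedConnected G (C - x)
    without x x∈C with ∈-fromList⁻ (a ∷ verts G P) x∈C
    ... | here refl = InducedConnected-if-hub λ u∈C-a →
      case ∈-fromList⁻ (a ∷ verts G P) (p─q⊆p C _ u∈C-a) of λ where
        (here refl) → contradiction refl (x∈p-y⇒x≢y u∈C-a)
        (there u∈P) → let q , q⊆P = back-to-b u∈P in
          walk-inside q λ z∈q → x∈p∧x≢y⇒x∈p-y (P⊆C (q⊆P z∈q)) λ { refl → a∉P (q⊆P z∈q) }
    ... | there x∈P = InducedConnected-if-hub to-a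
      where
      a≢x : a ≢ x
      a≢x refl = a∉P x∈P

      to-a : u ∈ C - x → InsideWalk G (C - x) u a
      to-a u∈C-x with ∈-fromList⁻ (a ∷ verts G P) (p─q⊆p C _ u∈C-x)
      ... | here refl = walk-inside [] λ { (here refl) → u∈C-x }
      ... | there u∈P with split-at P u∈P
      ...   | p₁ , p₂ , refl with x ∈ₗ? verts G p₁
      ...     | no x∉p₁ = detour a≢x p₁ (∈ʷ-++⁺ˡ p₁ p₂) x∉p₁ (reverse p₁ ++ʷ edge (~-sym a~b))
                  (Sum.map₁ (∈ʷ-reverse⁻ p₁) ∘ ∈ʷ-++-edge⁻ (reverse p₁) (~-sym a~b))
      ...     | yes x∈p₁ = detour a≢x p₂ (∈ʷ-++⁺ʳ p₁ p₂) x∉p₂ (p₂ ++ʷ edge (~-sym a~c))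
                  (∈ʷ-++-edge⁻ p₂ (~-sym a~c))
        where
        x∉p₂ : x ∉ʷ p₂
        x∉p₂ x∈p₂ = x∈p-y⇒x≢y u∈C-x (sym (path-++-meet p₁ p₂ P-path x∈p₁ x∈p₂))

  common-neighbour-separates : IsBlockGraph G → a ~ b → a ~ c → b ≢ c → ¬ b ~ c
                             → (p : Walk G b c) → a ∈ʷ p
  common-neighbour-separates {a} block-graph a~b a~c b≢c b≁c p =
    decidable-stable (a ∈ₗ? verts G p) λ a∉p →
      let P , P-path , P⊆p = walk⇒path p in
      ¬¬-maximal-extension (cycle-NoCutVertex a~b a~c P P-path (a∉p ∘ P⊆p)) λ (B , C⊆B , B-block) →
        b≁c (block-graph B B-block _ _ (C⊆B (∈-fromList⁺ (there (source∈ʷ P))))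
                                       (C⊆B (∈-fromList⁺ (there (target∈ʷ P)))) b≢c)

  simplicial-on-shortest-is-end : (p : Walk G a b) → Shortest G p → v ∈ʷ p → Simplicial G v → v ≡ a ⊎ v ≡ b
  simplicial-on-shortest-is-end []      _ (here refl) _ = inj₁ refl
  simplicial-on-shortest-is-end (e ∷ p) _ (here refl) _ = inj₁ refl
  simplicial-on-shortest-is-end (e ∷ []) _ (there (here refl)) _ = inj₂ refl
  simplicial-on-shortest-is-end {a} (e ∷ _∷_ {b = c} e′ p) p-short (there (here refl)) v-simplicial =
    ⊥-elim (shortcut (a ≟ c))
    where
    shortcut : Dec (a ≡ c) → ⊥
    shortcut (yes refl) = ≤⇒≯ (n≤1+n _) (p-short p)
    shortcut (no a≢c)   = ≤⇒≯ ≤-refl (p-short (v-simplicial _ _ (~-sym e) e′ a≢c ∷ p))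
  simplicial-on-shortest-is-end (e ∷ e′ ∷ p) p-short (there (there v∈p)) v-simplicial
    with simplicial-on-shortest-is-end (e′ ∷ p) (Shortest-++ʳ (edge e) (e′ ∷ p) p-short) (there v∈p) v-simplicial
  ... | inj₁ refl = contradiction v∈p (proj₁ (Shortest⇒IsPath (e′ ∷ p) (Shortest-++ʳ (edge e) (e′ ∷ p) p-short)))
  ... | inj₂ refl = inj₂ refl

  simplicial⇒IsTotalMutualVisibility : Connected G → (∀ {v} → v ∈ X → Simplicial G v) → IsTotalMutualVisibility G X
  simplicial⇒IsTotalMutualVisibility connected X-simplicial a b =
    let p , p-short = shortest-walk (connected a b) in
    p , p-short , All.tabulate λ v∈p v∈X → simplicial-on-shortest-is-end p p-short v∈p (X-simplicial v∈X)

  -- A shortest u,w-path visible to X avoids x, yet it must pass through their common neighbour x.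
  IsTotalMutualVisibility⇒simplicial : IsBlockGraph G → IsTotalMutualVisibility G X → x ∈ X → Simplicial G x
  IsTotalMutualVisibility⇒simplicial block-graph X-total x∈X u w x~u x~w u≢w =
    decidable-stable (T? (adj u w)) λ u≁w →
      let R , _ , R-visible = X-total u w in
      case All.lookup R-visible (common-neighbour-separates block-graph x~u x~w u≢w u≁w R) x∈X of λ where
        (inj₁ refl) → irrefl _ x~u
        (inj₂ refl) → irrefl _ x~w

  -- Gates of a maximal clique

  record Entry (B : Subset n) (x : Fin n) : Set where
    field
      {last} entrance  : Fin n
      approach         : Walk G x last
      approach-outside : ∀ {z} → z ∈ʷ approach → z ∉ B
      last~entrance    : last ~ entrance
      entrance∈B       : entrance ∈ B

  first-entry : (p : Walk G x b) → x ∉ B → b ∈ B → Entry B x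
  first-entry []                    x∉B x∈B = contradiction x∈B x∉B
  first-entry {B = B} (_∷_ {b = y} x~y p) x∉B b∈B with y ∈? B
  ... | yes y∈B = record
    { approach = [] ; approach-outside = λ { (here refl) → x∉B } ; last~entrance = x~y ; entrance∈B = y∈B }
  ... | no  y∉B = record
    { approach         = x~y ∷ approach
    ; approach-outside = λ { (here refl) → x∉B ; (there z∈A) → approach-outside z∈A }
    ; last~entrance    = last~entrance
    ; entrance∈B       = entrance∈B
    }
    where open Entry (first-entry p y∉B b∈B)

  Gate : Subset n → Fin n → Fin n → Set
  Gate B x g = g ∈ B × (∀ {b} → b ∈ B → (p : Walk G x b) → g ∈ʷ p)

  Gate-self : x ∈ B → Gate B x g → g ≡ x
  Gate-self x∈B (_ , g-separates) with g-separates x∈B []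
  ... | here g≡x = g≡x

  -- A walk from x into B avoiding the entrance g would close, with the approach and an
  -- edge of B, a walk between two non-adjacent neighbours of g that misses g.
  entrance-is-gate : IsBlockGraph G → IsMaximalClique G B → (en : Entry B x) → Gate B x (Entry.entrance en)
  entrance-is-gate {B = B} {x = x} block-graph B-max en = entrance∈B , separates
    where
    open Entry en

    B-complete : Complete G B
    B-complete = proj₁ B-max

    separates : b ∈ B → (p : Walk G x b) → entrance ∈ʷ p
    separates {b} b∈B p = decidable-stable (entrance ∈ₗ? verts G p) λ g∉p →
      let last∉B = approach-outside (target∈ʷ approach)
          w , w∈B , last≁w = maximal-clique-non-neighbour B-max last∉B
          t , _ , _ , t-ends = clique-geodesic B-complete b∈B w∈B
          g≢w : entrance ≢ w
          g≢w = λ g≡w → last≁w (subst (last ~_) g≡w last~entrance)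
          g∉detour : entrance ∉ʷ reverse approach ++ʷ p ++ʷ t
          g∉detour g∈ = case ∈ʷ-++⁻ (reverse approach) (p ++ʷ t) g∈ of λ where
            (inj₁ g∈A)  → approach-outside (∈ʷ-reverse⁻ approach g∈A) entrance∈B
            (inj₂ g∈pt) → case ∈ʷ-++⁻ p t g∈pt of λ where
              (inj₁ g∈p) → g∉p g∈p
              (inj₂ g∈t) → case t-ends g∈t of λ where
                (inj₁ refl) → g∉p (target∈ʷ p)
                (inj₂ g≡w)  → g≢w g≡w
          last≢w : last ≢ w
          last≢w = λ last≡w → last∉B (subst (_∈ B) (sym last≡w) w∈B)
      in g∉detour (common-neighbour-separates block-graph (~-sym last~entrance)
                    (B-complete _ w entrance∈B w∈B g≢w) last≢w last≁w _)

  -- A geodesic through b would run u … g … b … h … v, spending two steps between the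
  -- gates g and h of its ends where one suffices.
  non-gate-off-geodesics : Complete G B → Gate B u g → Gate B v h → b ∈ B → b ≢ g → b ≢ h
                         → (R : Walk G u v) → Shortest G R → b ∉ʷ R
  non-gate-off-geodesics B-complete (g∈B , g-separates) (h∈B , h-separates) b∈B b≢g b≢h R R-short b∈R
    with split-at R b∈R
  ... | q₁ , q₂ , refl
    with split-at q₁ (g-separates b∈B q₁) | split-at q₂ (∈ʷ-reverse⁻ q₂ (h-separates b∈B (reverse q₂)))
  ...   | s₁ , s₂ , refl | s₃ , s₄ , refl =
    let t , _ , len-t≤1 , _ = clique-geodesic B-complete g∈B h∈B in
    ≤⇒≯ (≤-trans (Shortest-middle s₁ s₂ s₃ s₄ R-short t) len-t≤1) two-steps
    where
    two-steps : 1 < len G (s₂ ++ʷ s₃)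
    two-steps = subst (1 <_) (sym (len-++ʷ s₂ s₃)) (+-mono-≤ (len-pos (b≢g ∘ sym) s₂) (len-pos b≢h s₃))

  -- Otherwise g lies on a path from u to its gate h, which then passes h already before g.
  gate-on-walk : Connected G → Gate B x g → Gate B u h → g ≢ h → (R : Walk G u x) → g ∈ʷ R
  gate-on-walk {u = u} {h = h} connected (g∈B , g-separates) (h∈B , h-separates) g≢h R
    with walk⇒path (connected u h)
  ... | S , S-path , _ with ∈ʷ-++⁻ (reverse R) S (g-separates h∈B (reverse R ++ʷ S))
  ...   | inj₁ g∈R⁻¹ = ∈ʷ-reverse⁻ R g∈R⁻¹
  ...   | inj₂ g∈S with split-at S g∈S
  ...     | S₁ , S₂ , refl =
    contradiction (path-++-meet S₁ S₂ S-path (h-separates g∈B S₁) (target∈ʷ S₂)) (g≢h ∘ sym)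

  -- Splitting the visible u,x-path at the gate g of x as P₁ P₂, the path b g P₂ serves.
  visible-from-clique : Connected G → Complete G B → Gate B x g → Gate B u h → g ≢ h → b ∈ B → b ≢ g
                      → Visible G X u x → Visible G (X ∪ ⁅ b ⁆) b x
  visible-from-clique {B} {x} {g} {u} {h} {b} {X} connected B-complete x-gate u-gate g≢h b∈B b≢g
                      (R , R-short , R-visible)
    with split-at R (gate-on-walk connected x-gate u-gate g≢h R)
  ... | P₁ , P₂ , refl = b~g ∷ P₂ , Q-short , All.tabulate Q-visible
    where
    g∈B : g ∈ B
    g∈B = proj₁ x-gate

    b~g : b ~ g
    b~g = B-complete b g b∈B g∈B b≢g

    Q-short : Shortest G (b~g ∷ P₂)
    Q-short q with split-at q (∈ʷ-reverse⁻ q (proj₂ x-gate b∈B (reverse q)))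
    ... | q₁ , q₂ , refl = subst (suc (len G P₂) ≤_) (sym (len-++ʷ q₁ q₂))
                             (+-mono-≤ (len-pos b≢g q₁) (Shortest-++ʳ P₁ P₂ R-short q₂))

    Q-visible : ∀ {z} → z ∈ʷ b~g ∷ P₂ → z ∈ X ∪ ⁅ b ⁆ → z ≡ b ⊎ z ≡ x
    Q-visible (here refl) _ = inj₁ refl
    Q-visible (there z∈P₂) z∈X∪b with x∈p∪q⁻ X ⁅ b ⁆ z∈X∪b
    ... | inj₂ z∈⁅b⁆ = inj₁ (x∈⁅y⁆⇒x≡y b z∈⁅b⁆)
    ... | inj₁ z∈X with All.lookup R-visible (∈ʷ-++⁺ʳ P₁ P₂ z∈P₂) z∈X
    ...   | inj₂ z≡x  = inj₂ z≡x
    ...   | inj₁ refl = contradiction (trans (Gate-self u∈B u-gate) u≡g) (g≢h ∘ sym)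
      where
      u≡g : u ≡ g
      u≡g = path-++-meet P₁ P₂ (Shortest⇒IsPath _ R-short) (source∈ʷ P₁) z∈P₂
      u∈B : u ∈ B
      u∈B = subst (_∈ B) (sym u≡g) g∈B

  module Gates (connected : Connected G) (block-graph : IsBlockGraph G)
               {B : Subset n} (B-max : IsMaximalClique G B) {b₀ : Fin n} (b₀∈B : b₀ ∈ B) where

    private
      B-complete : Complete G B
      B-complete = proj₁ B-max

    gate-exists : ∀ x → ∃[ g ] Gate B x g
    gate-exists x with x ∈? B
    ... | yes x∈B = x , x∈B , λ _ p → source∈ʷ p
    ... | no  x∉B = let en = first-entry (connected x b₀) x∉B b₀∈B in
                    Entry.entrance en , entrance-is-gate block-graph B-max en

    gate : Fin n → Fin n
    gate x = proj₁ (gate-exists x)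

    gate-spec : ∀ x → Gate B x (gate x)
    gate-spec x = proj₂ (gate-exists x)

    ∪-non-gate-is-MV : ∀ {x₁ x₂} → IsMutualVisibility G X → x₁ ∈ X → x₂ ∈ X → gate x₁ ≢ gate x₂
                     → b ∈ B → (∀ {x} → x ∈ X → gate x ≢ b) → IsMutualVisibility G (X ∪ ⁅ b ⁆)
    ∪-non-gate-is-MV {X} {b} {x₁} {x₂} X-mv x₁∈X x₂∈X gates-differ b∈B no-gate u v u∈ v∈ =
      by-cases (x∈p∪q⁻ X ⁅ b ⁆ u∈) (x∈p∪q⁻ X ⁅ b ⁆ v∈)
      where
      within-X : u ∈ X → v ∈ X → Visible G (X ∪ ⁅ b ⁆) u v
      within-X u∈X v∈X with X-mv _ _ u∈X v∈X
      ... | R , R-short , R-visible = R , R-short , All.tabulate λ {z} z∈R z∈X∪b →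
        case x∈p∪q⁻ X ⁅ b ⁆ z∈X∪b of λ where
          (inj₁ z∈X)   → All.lookup R-visible z∈R z∈X
          (inj₂ z∈⁅b⁆) → contradiction (subst (_∈ʷ R) (x∈⁅y⁆⇒x≡y b z∈⁅b⁆) z∈R)
            (non-gate-off-geodesics B-complete (gate-spec _) (gate-spec _) b∈B
               (no-gate u∈X ∘ sym) (no-gate v∈X ∘ sym) R R-short)

      through : ∀ {x y} → x ∈ X → y ∈ X → gate x ≢ gate y → Visible G (X ∪ ⁅ b ⁆) b x
      through x∈X y∈X differ = visible-from-clique connected B-complete (gate-spec _) (gate-spec _) differ
                                 b∈B (no-gate x∈X ∘ sym) (X-mv _ _ y∈X x∈X)

      from-b : x ∈ X → Visible G (X ∪ ⁅ b ⁆) b x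
      from-b {x} x∈X with gate x ≟ gate x₁
      ... | yes same = through x∈X x₂∈X λ same₂ → gates-differ (trans (sym same) same₂)
      ... | no  diff = through x∈X x₁∈X diff

      by-cases : u ∈ X ⊎ u ∈ ⁅ b ⁆ → v ∈ X ⊎ v ∈ ⁅ b ⁆ → Visible G (X ∪ ⁅ b ⁆) u v
      by-cases (inj₁ u∈X)   (inj₁ v∈X)   = within-X u∈X v∈X
      by-cases (inj₁ u∈X)   (inj₂ v∈⁅b⁆) rewrite x∈⁅y⁆⇒x≡y b v∈⁅b⁆ = Visible-reverse (from-b u∈X)
      by-cases (inj₂ u∈⁅b⁆) (inj₁ v∈X)   rewrite x∈⁅y⁆⇒x≡y b u∈⁅b⁆ = from-b v∈X
      by-cases (inj₂ u∈⁅b⁆) (inj₂ v∈⁅b⁆) rewrite x∈⁅y⁆⇒x≡y b u∈⁅b⁆ | x∈⁅y⁆⇒x≡y b v∈⁅b⁆ = Visible-refl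

    -- Otherwise b could be added to X without losing mutual visibility.
    gates-cover : ∀ {x₁ x₂} → Maximal G (IsMutualVisibility G) X → x₁ ∈ X → x₂ ∈ X → gate x₁ ≢ gate x₂
                → b ∈ B → ∃[ x ] x ∈ X × gate x ≡ b
    gates-cover {X} {b} X-max x₁∈X x₂∈X gates-differ b∈B =
      decidable-stable (any? λ x → x ∈? X ×-dec gate x ≟ b) λ no-x →
        let b∈X = Maximal-∪⁅⁆⇒∈ X-max (∪-non-gate-is-MV (proj₁ X-max) x₁∈X x₂∈X gates-differ b∈B
                                         λ x∈X gate≡b → no-x (_ , x∈X , gate≡b))
        in no-x (b , b∈X , Gate-self b∈B (gate-spec b))

  maximal-MV-two-members : 2 ≤ n → Connected G → Maximal G (IsMutualVisibility G) X
                         → ∃[ x₁ ] ∃[ x₂ ] x₁ ∈ X × x₂ ∈ X × x₁ ≢ x₂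
  maximal-MV-two-members {X} 2≤n connected X-max with nonempty? X
  ... | no X-empty =
    let i , _ = two-distinct 2≤n
        X-clique = Complete-subsingleton λ u∈X _ → contradiction (_ , u∈X) X-empty
    in contradiction (i , Maximal-∪⁅⁆⇒∈ X-max (Complete⇒IsMutualVisibility
                        (Complete-∪⁅⁆ X-clique λ w∈X → contradiction (_ , w∈X) X-empty))) X-empty
  ... | yes (x , x∈X) with nonempty? (X - x)
  ...   | yes (x₂ , x₂∈X-x) = x₂ , x , p─q⊆p X _ x₂∈X-x , x∈X , x∈p-y⇒x≢y x₂∈X-x
  ...   | no  X⊆⁅x⁆ =
    let y , x~y = has-neighbour 2≤n connected x
        y∈X = Maximal-∪⁅⁆⇒∈ X-max (Complete⇒IsMutualVisibility
                (Complete-∪⁅⁆ (Complete-subsingleton λ u∈X w∈X → trans (only-x u∈X) (sym (only-x w∈X)))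
                              λ w∈X → subst (y ~_) (sym (only-x w∈X)) (~-sym x~y)))
    in ⊥-elim (irrefl x (subst (x ~_) (only-x y∈X) x~y))
    where
    only-x : w ∈ X → w ≡ x
    only-x {w} w∈X = decidable-stable (w ≟ x) λ w≢x → X⊆⁅x⁆ (w , x∈p∧x≢y⇒x∈p-y w∈X w≢x)

  -- The entrance g of y into X lies on the visible path from y to a non-neighbour w ∈ X of
  -- the vertex before g, although g ∈ Y is neither y nor w.
  maximal-clique⇒maximal-MV : Connected G → IsBlockGraph G → IsMaximalClique G X
                            → Maximal G (IsMutualVisibility G) X
  maximal-clique⇒maximal-MV {X} connected block-graph X-max =
    maximal-if-no-strict-extension (Complete⇒IsMutualVisibility (proj₁ X-max)) no-extension
    where
    no-extension : ∀ Y → X ⊂ Y → ¬ IsMutualVisibility G Y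
    no-extension Y (X⊆Y , y , y∈Y , y∉X) Y-mv =
      let w₀ , w₀∈X = maximal-clique-nonempty X-max y in
      blocked (first-entry (connected y w₀) y∉X w₀∈X)
      where
      blocked : Entry X y → ⊥
      blocked en with maximal-clique-non-neighbour X-max (Entry.approach-outside en (target∈ʷ (Entry.approach en)))
      ... | w , w∈X , last≁w with Y-mv y w y∈Y (X⊆Y w∈X)
      ...   | R , _ , R-visible
        with All.lookup R-visible (proj₂ (entrance-is-gate block-graph X-max en) w∈X R) (X⊆Y (Entry.entrance∈B en))
      ...     | inj₁ g≡y = y∉X (subst (_∈ X) g≡y (Entry.entrance∈B en))
      ...     | inj₂ g≡w = last≁w (subst (Entry.last en ~_) g≡w (Entry.last~entrance en))

  maximal-MV-dominates-clique : 2 ≤ n → Connected G → IsBlockGraph G → Maximal G (IsMutualVisibility G) X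
                              → ¬ ¬ (∃[ B ] IsMaximalClique G B × ∣ B ∣ ≤ ∣ X ∣)
  maximal-MV-dominates-clique {X} 2≤n connected block-graph X-max
    with maximal-MV-two-members 2≤n connected X-max
  ... | x₁ , x₂ , x₁∈X , x₂∈X , x₁≢x₂ with proj₁ X-max x₁ x₂ x₁∈X x₂∈X
  ...   | [] , _ = contradiction refl x₁≢x₂
  ...   | _∷_ {b = p₁} x₁~p₁ R′ , R-short , _ = λ no-bound →
    ¬¬-maximal-extension edge-clique λ (B , edge⊆B , B-max) → no-bound (B , B-max , bound B-max edge⊆B)
    where
    edge-clique : Complete G (⁅ x₁ ⁆ ∪ ⁅ p₁ ⁆)
    edge-clique = Complete-∪⁅⁆ Complete-⁅⁆ λ w∈⁅x₁⁆ → subst (p₁ ~_) (sym (x∈⁅y⁆⇒x≡y x₁ w∈⁅x₁⁆)) (~-sym x₁~p₁)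

    bound : ∀ {B} → IsMaximalClique G B → ⁅ x₁ ⁆ ∪ ⁅ p₁ ⁆ ⊆ B → ∣ B ∣ ≤ ∣ X ∣
    bound {B} B-max edge⊆B = p⊆f[q]⇒∣p∣≤∣q∣ gate (gates-cover X-max x₁∈X x₂∈X gates-differ)
      where
      x₁∈B : x₁ ∈ B
      x₁∈B = edge⊆B (x∈p∪q⁺ (inj₁ (x∈⁅x⁆ x₁)))

      p₁∈B : p₁ ∈ B
      p₁∈B = edge⊆B (x∈p∪q⁺ (inj₂ (x∈⁅x⁆ p₁)))

      open Gates connected block-graph B-max x₁∈B

      gates-differ : gate x₁ ≢ gate x₂
      gates-differ gates-equal =
        proj₁ (Shortest⇒IsPath (x₁~p₁ ∷ R′) R-short)
          (∈ʷ-reverse⁻ R′ (subst (_∈ʷ reverse R′) (trans (sym gates-equal) (Gate-self x₁∈B (gate-spec x₁)))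
                                                    (proj₂ (gate-spec x₂) p₁∈B (reverse R′))))

theorem5p1 : ∀ {n : ℕ} (G : Graph n) → 2 ≤ n → Connected G → IsBlockGraph G
    → (S : Subset n) → (∀ v → (v ∈ S) ⇔ Simplicial G v)
    → (W : Subset n) → IsMaximalClique G W → (∀ W′ → IsMaximalClique G W′ → ∣ W ∣ ≤ ∣ W′ ∣)
    → μ⁻t≡ G ∣ S ∣ × μ⁻≡ G ∣ W ∣
theorem5p1 G 2≤n connected block-graph S S-simplicial W W-max W-minimum = μ⁻t≡∣S∣ , μ⁻≡∣W∣
  where
  μ⁻t≡∣S∣ : μ⁻t≡ G ∣ S ∣
  μ⁻t≡∣S∣ = greatest⇒IsMinCard-Maximal G
    (simplicial⇒IsTotalMutualVisibility G connected (Equivalence.to (S-simplicial _)))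
    (λ X X-total x∈X → Equivalence.from (S-simplicial _)
                         (IsTotalMutualVisibility⇒simplicial G block-graph X-total x∈X))

  μ⁻≡∣W∣ : μ⁻≡ G ∣ W ∣
  μ⁻≡∣W∣ = (W , maximal-clique⇒maximal-MV G connected block-graph W-max , refl)
         , λ X X-max → decidable-stable (∣ W ∣ ≤ℕ? ∣ X ∣) λ W≰X →
             maximal-MV-dominates-clique G 2≤n connected block-graph X-max
               λ (B , B-max , B≤X) → W≰X (≤-trans (W-minimum B B-max) B≤X)
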